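{- Let $n$ be an even perfect square. Then $D_{S(n)^*}\geq 4$.
   Context: $\mathbb Z_n=\mathbb Z/n\mathbb Z$; $S(n)^*=\{x^2:x\in\mathbb Z_n\}\setminus\{0\}$. For $A\subseteq\mathbb Z_n$, a subsequence $T$ of a sequence $(x_1,\dots,x_k)$ in $\mathbb Z_n$, with nonempty index set $I$, is an $A$-weighted zero-sum subsequence if there exist $a_i\in A$ ($i\in I$) with $\sum_{i\in I}a_ix_i=0$. $D_{S(n)^*}$ is the least positive integer $k$ such that every sequence of length $k$ in $\mathbb Z_n$ has an $S(n)^*$-weighted zero-sum subsequence. -}

module Defs where

open import Data.Nat using (ℕ; zero; suc; _+_; _*_; NonZero)
open import Data.Nat.DivMod using (_%_)
open import Data.Fin using (Fin; toℕ)
open import Data.Fin.Subset using (Subset; _∈_; Nonempty)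
open import Data.Vec using (lookup)
open import Data.Bool using (if_then_else_)
open import Data.Product using (Σ; _×_; ∃)
open import Relation.Binary.PropositionalEquality using (_≡_; _≢_)

-- Elements of ℤ_n are represented by Fin n (residues 0..n-1);
-- arithmetic is ℕ-arithmetic on representatives reduced mod n.

sumFin : (k : ℕ) → (Fin k → ℕ) → ℕ
sumFin zero    f = 0
sumFin (suc k) f = f Fin.zero + sumFin k (λ i → f (Fin.suc i))

InSStar : (n : ℕ) → .{{_ : NonZero n}} → Fin n → Set
InSStar n a = (toℕ a ≢ 0) × Σ (Fin n) (λ x → (toℕ x * toℕ x) % n ≡ toℕ a)

-- The subsequence of the sequence x indexed by I is an S(n)*-weighted
-- zero-sum subsequence: I nonempty and there exist weights a_i ∈ S(n)*
-- (i ∈ I) with Σ_{i ∈ I} a_i x_i = 0 in ℤ_n.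
-- (Weights are given for all indices, but only those in I are constrained/used.)
WeightedZeroSum : (n : ℕ) → .{{_ : NonZero n}} → (k : ℕ) →
                  (Fin k → Fin n) → Subset k → Set
WeightedZeroSum n k x I =
  Nonempty I ×
  Σ (Fin k → Fin n) (λ a →
    ((i : Fin k) → i ∈ I → InSStar n (a i)) ×
    (sumFin k (λ i → if lookup I i then toℕ (a i) * toℕ (x i) else 0) % n ≡ 0))

AllHaveWZS : (n : ℕ) → .{{_ : NonZero n}} → ℕ → Set
AllHaveWZS n k = (x : Fin k → Fin n) → Σ (Subset k) (λ I → WeightedZeroSum n k x I)

-- Write n = m².  For every prime p there are x₂, x₃ such that p² ∣ z₁² + x₂z₂² + x₃z₃² forces
-- p ∣ z₁, z₂, z₃: take x₂ = x₃ = 1 for p = 2 (squares are 0 or 1 mod 4), and x₂ = p, x₃ = -e for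
-- an odd p and a quadratic non-residue e.  Gluing these by the Chinese remainder theorem and
-- peeling off one prime of m at a time gives x₂, x₃ with m² ∣ z₁² + x₂z₂² + x₃z₃² ⇒ m ∣ z₁, z₂, z₃.
-- A nonzero square weight is z² with m ∤ z, so the sequence (1, x₂, x₃) has no S(n)*-weighted
-- zero-sum subsequence, and D_{S(n)*} > 3.
module Submission where

open import Defs
open import Data.Bool using (Bool; true; false; if_then_else_)
open import Data.Empty using (⊥-elim)
open import Data.Fin as Fin using (Fin; toℕ; fromℕ<)
open import Data.Fin.Properties using (pigeonhole; any?; ¬∀⟶∃¬; toℕ<n; toℕ-fromℕ<)
open import Data.List using ([]; _∷_)
open import Data.List.Membership.Propositional using (_∈_)
open import Data.List.Relation.Unary.All as All using (All; []; _∷_)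
open import Data.Nat
open import Data.Nat.Coprimality as Coprime using (Coprime; coprime-Bézout; coprime-divisor)
open import Data.Nat.DivMod
  using (_%_; %-distribˡ-+; %-distribˡ-*; %-remove-+ʳ; m%n%n≡m%n; m∣n⇒o%n%m≡o%m; m%n<n;
         m<n⇒m%n≡m; [m+kn]%n≡m%n)
open import Data.Nat.Divisibility
open import Data.Nat.GCD using (module Bézout)
open import Data.Nat.ListAction using (product)
open import Data.Nat.ListAction.Properties using (∈⇒∣product)
open import Data.Nat.Primality
open import Data.Nat.Primality.Factorisation
open import Data.Nat.Properties
open import Data.Nat.Tactic.RingSolver using (solve-∀)
open import Data.Product using (∃; ∃₂; _×_; _,_; proj₁; proj₂)
open import Data.Sum using (inj₁; inj₂; [_,_]′)
open import Data.Vec using (_∷_; lookup; _[_]=_; there)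
open import Data.Vec.Properties using ([]=⇒lookup; lookup⇒[]=)
open import Function using (id; _∘_)
open import Relation.Binary.PropositionalEquality
open import Relation.Nullary using (¬_; yes; no)

infix 4 _≡_mod_
record _≡_mod_ (a b n : ℕ) .{{_ : NonZero n}} : Set where
  constructor ≡-mod
  field %-≡ : a % n ≡ b % n

module _ {n : ℕ} .{{_ : NonZero n}} where

  ≡-mod-reflexive : ∀ {a b} → a ≡ b → a ≡ b mod n
  ≡-mod-reflexive a≡b = ≡-mod (cong (_% n) a≡b)

  ≡-mod-refl : ∀ {a} → a ≡ a mod n
  ≡-mod-refl = ≡-mod refl

  ≡-mod-sym : ∀ {a b} → a ≡ b mod n → b ≡ a mod n
  ≡-mod-sym (≡-mod a≡b) = ≡-mod (sym a≡b)

  ≡-mod-trans : ∀ {a b c} → a ≡ b mod n → b ≡ c mod n → a ≡ c mod n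
  ≡-mod-trans (≡-mod a≡b) (≡-mod b≡c) = ≡-mod (trans a≡b b≡c)

  %-≡-mod : ∀ a → a % n ≡ a mod n
  %-≡-mod a = ≡-mod (m%n%n≡m%n a n)

  ∣⇒≡0-mod : ∀ {a} → n ∣ a → a ≡ 0 mod n
  ∣⇒≡0-mod (divides q refl) = ≡-mod ([m+kn]%n≡m%n 0 q n)

  ≡0-mod⇒∣ : ∀ {a} → a % n ≡ 0 → n ∣ a
  ≡0-mod⇒∣ {a} = m%n≡0⇒n∣m a n

  +-cong-mod : ∀ {a b c d} → a ≡ b mod n → c ≡ d mod n → a + c ≡ b + d mod n
  +-cong-mod {a} {b} {c} {d} (≡-mod a≡b) (≡-mod c≡d) = ≡-mod (begin
    (a + c) % n           ≡⟨ %-distribˡ-+ a c n ⟩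
    (a % n + c % n) % n   ≡⟨ cong₂ (λ u v → (u + v) % n) a≡b c≡d ⟩
    (b % n + d % n) % n   ≡⟨ %-distribˡ-+ b d n ⟨
    (b + d) % n           ∎)
    where open ≡-Reasoning

  *-cong-mod : ∀ {a b c d} → a ≡ b mod n → c ≡ d mod n → a * c ≡ b * d mod n
  *-cong-mod {a} {b} {c} {d} (≡-mod a≡b) (≡-mod c≡d) = ≡-mod (begin
    (a * c) % n             ≡⟨ %-distribˡ-* a c n ⟩
    (a % n * (c % n)) % n   ≡⟨ cong₂ (λ u v → (u * v) % n) a≡b c≡d ⟩
    (b % n * (d % n)) % n   ≡⟨ %-distribˡ-* b d n ⟨
    (b * d) % n             ∎)
    where open ≡-Reasoning

  ∣-resp-≡-mod : ∀ {a b} → a ≡ b mod n → n ∣ a → n ∣ b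
  ∣-resp-≡-mod {a} {b} (≡-mod a≡b) n∣a = m%n≡0⇒n∣m b n (trans (sym a≡b) (n∣m⇒m%n≡0 a n n∣a))

  ∣+∣⇒≡-mod : ∀ {a b c} → n ∣ a + c → n ∣ b + c → a ≡ b mod n
  ∣+∣⇒≡-mod {a} {b} {c} n∣a+c n∣b+c = ≡-mod (begin
    a % n             ≡⟨ %-remove-+ʳ a n∣b+c ⟨
    (a + (b + c)) % n ≡⟨ cong (_% n) (swap a b c) ⟩
    (b + (a + c)) % n ≡⟨ %-remove-+ʳ b n∣a+c ⟩
    b % n             ∎)
    where
    open ≡-Reasoning
    swap : ∀ a b c → a + (b + c) ≡ b + (a + c)
    swap = solve-∀

  sumFin-cong-mod : ∀ k {f g : Fin k → ℕ} → (∀ i → f i ≡ g i mod n) →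
                    sumFin k f ≡ sumFin k g mod n
  sumFin-cong-mod zero    f≡g = ≡-mod-refl
  sumFin-cong-mod (suc k) f≡g = +-cong-mod (f≡g Fin.zero) (sumFin-cong-mod k (f≡g ∘ Fin.suc))

≡-mod-weaken : ∀ {m n a b} .{{_ : NonZero m}} .{{_ : NonZero n}} →
               m ∣ n → a ≡ b mod n → a ≡ b mod m
≡-mod-weaken {m} {n} {a} {b} m∣n (≡-mod a≡b) = ≡-mod (begin
  a % m       ≡⟨ m∣n⇒o%n%m≡o%m m n a m∣n ⟨
  a % n % m   ≡⟨ cong (_% m) a≡b ⟩
  b % n % m   ≡⟨ m∣n⇒o%n%m≡o%m m n b m∣n ⟩
  b % m       ∎)
  where open ≡-Reasoning

prime∤⇒coprime : ∀ {p n} → Prime p → ¬ p ∣ n → Coprime p n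
prime∤⇒coprime pPrime p∤n (d∣p , d∣n) with prime⇒irreducible pPrime d∣p
... | inj₁ d≡1    = d≡1
... | inj₂ refl   = ⊥-elim (p∤n d∣n)

coprime-*ʳ : ∀ {m n o} → Coprime m n → Coprime m o → Coprime m (n * o)
coprime-*ʳ m⊥n m⊥o (d∣m , d∣n*o) =
  m⊥o (d∣m , coprime-divisor (λ (i∣d , i∣n) → m⊥n (∣-trans i∣d d∣m , i∣n)) d∣n*o)

coprime-squares : ∀ {m n} → Coprime m n → Coprime (m * m) (n * n)
coprime-squares m⊥n = Coprime.sym (coprime-*ʳ m⊥n² m⊥n²)
  where m⊥n² = Coprime.sym (coprime-*ʳ m⊥n m⊥n)

coprime⇒∃-idempotent : ∀ {m n} .{{_ : NonZero n}} → Coprime m n → ∃ λ e → m ∣ e × e ≡ 1 mod n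
coprime⇒∃-idempotent {m} {n} m⊥n with coprime-Bézout m⊥n
... | Bézout.+- x y 1+yn≡xm =
  x * m , n∣m*n x , ≡-mod-trans (≡-mod-reflexive (sym 1+yn≡xm)) (≡-mod ([m+kn]%n≡m%n 1 y n))
... | Bézout.-+ x y 1+xm≡yn =
  (n ∸ 1) * (x * m) , ∣n⇒∣m*n (n ∸ 1) (n∣m*n x) , ∣+∣⇒≡-mod n∣e+n-1 n∣1+n-1
  where
  -- x m ≡ -1, so e = (n - 1) x m ≡ 1; without subtraction: e + (n - 1) = (n - 1) y n.
  n∣e+n-1 : n ∣ (n ∸ 1) * (x * m) + (n ∸ 1)
  n∣e+n-1 = subst (n ∣_) (trans (cong ((n ∸ 1) *_) (sym 1+xm≡yn)) (distrib (n ∸ 1) (x * m)))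
                  (∣n⇒∣m*n (n ∸ 1) (n∣m*n y))
    where
    distrib : ∀ a b → a * (1 + b) ≡ a * b + a
    distrib = solve-∀
  n∣1+n-1 : n ∣ 1 + (n ∸ 1)
  n∣1+n-1 = ∣-reflexive (sym (m+[n∸m]≡n (>-nonZero⁻¹ n)))

chinese-remainder : ∀ {m n} .{{_ : NonZero m}} .{{_ : NonZero n}} → Coprime m n →
                    ∀ u v → ∃ λ x → x ≡ u mod m × x ≡ v mod n
chinese-remainder {m} {n} m⊥n u v
  with e , m∣e , e≡1 ← coprime⇒∃-idempotent m⊥n
     | f , n∣f , f≡1 ← coprime⇒∃-idempotent (Coprime.sym m⊥n) =
  u * f + v * e ,
  ≡-mod-trans (+-cong-mod (*-cong-mod (≡-mod-refl {a = u}) f≡1)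
                          (*-cong-mod (≡-mod-refl {a = v}) (∣⇒≡0-mod m∣e)))
              (≡-mod-reflexive (select₁ u v)) ,
  ≡-mod-trans (+-cong-mod (*-cong-mod (≡-mod-refl {a = u}) (∣⇒≡0-mod n∣f))
                          (*-cong-mod (≡-mod-refl {a = v}) e≡1))
              (≡-mod-reflexive (select₂ u v))
  where
  select₁ : ∀ u v → u * 1 + v * 0 ≡ u
  select₁ = solve-∀
  select₂ : ∀ u v → u * 0 + v * 1 ≡ v
  select₂ = solve-∀

form : ℕ → ℕ → ℕ → ℕ → ℕ → ℕ
form x₂ x₃ z₁ z₂ z₃ = z₁ * z₁ + x₂ * (z₂ * z₂) + x₃ * (z₃ * z₃)

Anisotropic : ℕ → ℕ → ℕ → Set
Anisotropic p x₂ x₃ = ∀ z₁ z₂ z₃ → p * p ∣ form x₂ x₃ z₁ z₂ z₃ → p ∣ z₁ × p ∣ z₂ × p ∣ z₃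

anisotropic-cong : ∀ {p x₂ x₃ a₂ a₃} .{{_ : NonZero (p * p)}} →
                   x₂ ≡ a₂ mod (p * p) → x₃ ≡ a₃ mod (p * p) →
                   Anisotropic p a₂ a₃ → Anisotropic p x₂ x₃
anisotropic-cong x₂≡a₂ x₃≡a₃ anisotropic z₁ z₂ z₃ =
  anisotropic z₁ z₂ z₃ ∘ ∣-resp-≡-mod
    (+-cong-mod (+-cong-mod ≡-mod-refl (*-cong-mod x₂≡a₂ ≡-mod-refl)) (*-cong-mod x₃≡a₃ ≡-mod-refl))

anisotropic-1 : ∀ {x₂ x₃} → Anisotropic 1 x₂ x₃
anisotropic-1 _ _ _ _ = 1∣ _ , 1∣ _ , 1∣ _

form-scale : ∀ x₂ x₃ w₁ w₂ w₃ p →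
             form x₂ x₃ (w₁ * p) (w₂ * p) (w₃ * p) ≡ (p * p) * form x₂ x₃ w₁ w₂ w₃
form-scale = scale
  where
  scale : ∀ x₂ x₃ w₁ w₂ w₃ p →
    (w₁ * p) * (w₁ * p) + x₂ * ((w₂ * p) * (w₂ * p)) + x₃ * ((w₃ * p) * (w₃ * p)) ≡
    (p * p) * (w₁ * w₁ + x₂ * (w₂ * w₂) + x₃ * (w₃ * w₃))
  scale = solve-∀

anisotropic-* : ∀ {p q x₂ x₃} .{{_ : NonZero p}} →
                Anisotropic p x₂ x₃ → Anisotropic q x₂ x₃ → Anisotropic (p * q) x₂ x₃
anisotropic-* {p} {q} {x₂} {x₃} anisoP anisoQ z₁ z₂ z₃ pq²∣Q
  with anisoP z₁ z₂ z₃ (∣-trans (*-pres-∣ (m∣m*n {p} q) (m∣m*n q)) pq²∣Q)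
... | divides w₁ refl , divides w₂ refl , divides w₃ refl
  with anisoQ w₁ w₂ w₃ (*-cancelˡ-∣ (p * p) {{m*n≢0 p p}}
         (subst₂ _∣_ ([m*n]*[o*p]≡[m*o]*[n*p] p q p q) (form-scale x₂ x₃ w₁ w₂ w₃ p) pq²∣Q))
... | q∣w₁ , q∣w₂ , q∣w₃ = pq∣ q∣w₁ , pq∣ q∣w₂ , pq∣ q∣w₃
  where
  pq∣ : ∀ {w} → q ∣ w → p * q ∣ w * p
  pq∣ {w} q∣w = subst (_∣ w * p) (*-comm q p) (*-monoˡ-∣ p q∣w)

anisotropic-product : ∀ {ps x₂ x₃} → All Prime ps →
                      All (λ p → Anisotropic p x₂ x₃) ps → Anisotropic (product ps) x₂ x₃
anisotropic-product {[]}     {x₂} {x₃} []                []                 = anisotropic-1 {x₂} {x₃}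
anisotropic-product {p ∷ ps} {x₂} {x₃} (pPrime ∷ primes) (anisoP ∷ anisos) =
  anisotropic-* {p} {product ps} {x₂} {x₃} {{prime⇒nonZero pPrime}}
    anisoP (anisotropic-product {ps} {x₂} {x₃} primes anisos)

square%4≡%2 : ∀ z → z * z % 4 ≡ z % 2
square%4≡%2 z = begin
  z * z % 4             ≡⟨ _≡_mod_.%-≡ (*-cong-mod (≡-mod-sym (%-≡-mod z)) (≡-mod-sym (%-≡-mod z))) ⟩
  z % 4 * (z % 4) % 4   ≡⟨ residues (z % 4) (m%n<n z 4) ⟩
  z % 4 % 2             ≡⟨ m∣n⇒o%n%m≡o%m 2 4 z (divides 2 refl) ⟩
  z % 2                 ∎
  where
  open ≡-Reasoning
  residues : ∀ r → r < 4 → r * r % 4 ≡ r % 2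
  residues 0 _ = refl
  residues 1 _ = refl
  residues 2 _ = refl
  residues 3 _ = refl
  residues (suc (suc (suc (suc _)))) (s≤s (s≤s (s≤s (s≤s ()))))

bits-sum≡0 : ∀ {a b c} → a < 2 → b < 2 → c < 2 → (a + 1 * b + 1 * c) % 4 ≡ 0 →
             a ≡ 0 × b ≡ 0 × c ≡ 0
bits-sum≡0 {0} {0} {0} _ _ _ _ = refl , refl , refl
bits-sum≡0 {0} {0} {1} _ _ _ ()
bits-sum≡0 {0} {1} {0} _ _ _ ()
bits-sum≡0 {0} {1} {1} _ _ _ ()
bits-sum≡0 {1} {0} {0} _ _ _ ()
bits-sum≡0 {1} {0} {1} _ _ _ ()
bits-sum≡0 {1} {1} {0} _ _ _ ()
bits-sum≡0 {1} {1} {1} _ _ _ ()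
bits-sum≡0 {suc (suc _)} (s≤s (s≤s ())) _ _ _
bits-sum≡0 {b = suc (suc _)} _ (s≤s (s≤s ())) _ _
bits-sum≡0 {c = suc (suc _)} _ _ (s≤s (s≤s ())) _

anisotropic-2 : Anisotropic 2 1 1
anisotropic-2 z₁ z₂ z₃ 4∣Q =
  let e₁ , e₂ , e₃ = bits-sum≡0 (m%n<n z₁ 2) (m%n<n z₂ 2) (m%n<n z₃ 2)
                       (trans (sym (_≡_mod_.%-≡ Q≡bits)) (n∣m⇒m%n≡0 _ 4 4∣Q))
  in ≡0-mod⇒∣ e₁ , ≡0-mod⇒∣ e₂ , ≡0-mod⇒∣ e₃
  where
  square≡bit : ∀ z → z * z ≡ z % 2 mod 4
  square≡bit z = ≡-mod (trans (square%4≡%2 z) (sym (m<n⇒m%n≡m (≤-trans (m%n<n z 2) (s≤s (s≤s z≤n))))))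
  Q≡bits : form 1 1 z₁ z₂ z₃ ≡ z₁ % 2 + 1 * (z₂ % 2) + 1 * (z₃ % 2) mod 4
  Q≡bits = +-cong-mod (+-cong-mod (square≡bit z₁) (*-cong-mod (≡-mod-refl {a = 1}) (square≡bit z₂)))
                      (*-cong-mod (≡-mod-refl {a = 1}) (square≡bit z₃))

NonResidue : (p : ℕ) .{{_ : NonZero p}} → ℕ → Set
NonResidue p e = ∀ t → ¬ (t * t ≡ e mod p)

-- Squares of 0, …, p - 2 already give every square mod p (as (p - 1)² ≡ 1²), so they miss a residue.
∃-nonResidue : ∀ {p} .{{_ : NonZero p}} → 3 ≤ p → ∃ λ e → e < p × NonResidue p e
∃-nonResidue {1}     (s≤s ())
∃-nonResidue {2}     (s≤s (s≤s ()))
∃-nonResidue {suc (suc k@(suc _))} _ = toℕ e , toℕ<n e , nonResidue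
  where
  p = suc (suc k)

  SmallSquare : Fin p → Set
  SmallSquare e = ∃ λ (s : Fin (suc k)) → toℕ s * toℕ s % p ≡ toℕ e

  ¬allSmallSquares : ¬ (∀ e → SmallSquare e)
  ¬allSmallSquares small with i , j , i<j , rootᵢ≡rootⱼ ← pigeonhole (n<1+n (suc k)) (proj₁ ∘ small) =
    <-irrefl (trans (sym (proj₂ (small i)))
                    (trans (cong (λ s → toℕ s * toℕ s % p) rootᵢ≡rootⱼ) (proj₂ (small j)))) i<j

  notSmall : ∃ λ e → ¬ SmallSquare e
  notSmall = ¬∀⟶∃¬ p SmallSquare (λ e → any? (λ s → toℕ s * toℕ s % p ≟ toℕ e)) ¬allSmallSquares

  e : Fin p
  e = proj₁ notSmall

  [1+k]²≡1+kp : suc k * suc k ≡ 1 + k * p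
  [1+k]²≡1+kp = expand k
    where
    expand : ∀ k → suc k * suc k ≡ 1 + k * suc (suc k)
    expand = solve-∀

  small-root : ∀ t → ∃ λ (s : Fin (suc k)) → toℕ s * toℕ s ≡ t * t mod p
  small-root t with m<1+n⇒m<n∨m≡n (m%n<n t p)
  ... | inj₁ t%p<1+k = fromℕ< t%p<1+k ,
    subst (λ r → r * r ≡ t * t mod p) (sym (toℕ-fromℕ< t%p<1+k))
          (*-cong-mod (%-≡-mod t) (%-≡-mod t))
  ... | inj₂ t%p≡1+k = Fin.suc Fin.zero , ≡-mod-sym
    (≡-mod-trans (*-cong-mod (≡-mod-sym (%-≡-mod t)) (≡-mod-sym (%-≡-mod t)))
      (≡-mod-trans (≡-mod-reflexive (trans (cong₂ _*_ t%p≡1+k t%p≡1+k) [1+k]²≡1+kp))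
                   (≡-mod ([m+kn]%n≡m%n 1 k p))))

  nonResidue : NonResidue p (toℕ e)
  nonResidue t t²≡e with s , s²≡t² ← small-root t =
    proj₂ notSmall (s , trans (_≡_mod_.%-≡ (≡-mod-trans s²≡t² t²≡e)) (m<n⇒m%n≡m (toℕ<n e)))

module _ {p} (pPrime : Prime p) where

  private instance
    p≢0 : NonZero p
    p≢0 = prime⇒nonZero pPrime

  prime∣square⇒∣ : ∀ {a} → p ∣ a * a → p ∣ a
  prime∣square⇒∣ {a} = [ id , id ]′ ∘ euclidsLemma a a pPrime

  -- y b ≡ ±1 (mod p) by Bézout; squaring removes the sign.
  ∃-square-inverse : ∀ {b} → ¬ p ∣ b → ∃ λ y → (y * b) * (y * b) ≡ 1 mod p
  ∃-square-inverse {b} p∤b with coprime-Bézout (prime∤⇒coprime pPrime p∤b)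
  ... | Bézout.+- x y 1+yb≡xp = y , ∣+∣⇒≡-mod p∣u²+u p∣1+u
    where
    u = y * b
    p∣1+u : p ∣ 1 + u
    p∣1+u = divides x 1+yb≡xp
    p∣u²+u : p ∣ u * u + u
    p∣u²+u = subst (p ∣_) (factor u) (∣n⇒∣m*n u p∣1+u)
      where
      factor : ∀ u → u * (1 + u) ≡ u * u + u
      factor = solve-∀
  ... | Bézout.-+ x y 1+xp≡yb = y , *-cong-mod yb≡1 yb≡1
    where
    yb≡1 : y * b ≡ 1 mod p
    yb≡1 = ≡-mod-trans (≡-mod-reflexive (sym 1+xp≡yb)) (≡-mod ([m+kn]%n≡m%n 1 x p))

  nonResidue⇒anisotropic₂ : ∀ {c e} → NonResidue p e → p ∣ e + c →
                            ∀ a b → p ∣ a * a + c * (b * b) → p ∣ a × p ∣ b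
  nonResidue⇒anisotropic₂ {c} {e} nonResidue p∣e+c a b p∣a²+cb² with p ∣? b
  ... | yes p∣b = prime∣square⇒∣ (∣m+n∣m⇒∣n p∣cb²+a² (∣n⇒∣m*n c (∣n⇒∣m*n b p∣b))) , p∣b
    where
    p∣cb²+a² : p ∣ c * (b * b) + a * a
    p∣cb²+a² = subst (p ∣_) (+-comm (a * a) (c * (b * b))) p∣a²+cb²
  -- With b invertible, t = a y and u = y b satisfy t² + c u² = y² (a² + c b²) ≡ 0 and u² ≡ 1,
  -- so t² ≡ -c ≡ e.
  ... | no p∤b with y , [yb]²≡1 ← ∃-square-inverse p∤b =
    ⊥-elim (nonResidue (a * y) (∣+∣⇒≡-mod p∣t²+c p∣e+c))
    where
    rescale : ∀ a b c y → (a * y) * (a * y) + c * ((y * b) * (y * b)) ≡ (y * y) * (a * a + c * (b * b))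
    rescale = solve-∀
    p∣t²+cu² : p ∣ (a * y) * (a * y) + c * ((y * b) * (y * b))
    p∣t²+cu² = subst (p ∣_) (sym (rescale a b c y)) (∣n⇒∣m*n (y * y) p∣a²+cb²)
    p∣t²+c : p ∣ (a * y) * (a * y) + c
    p∣t²+c = ∣-resp-≡-mod
      (≡-mod-trans (+-cong-mod (≡-mod-refl {a = (a * y) * (a * y)}) (*-cong-mod (≡-mod-refl {a = c}) [yb]²≡1))
                   (≡-mod-reflexive (cong ((a * y) * (a * y) +_) (*-identityʳ c))))
      p∣t²+cu²

  nonResidue⇒anisotropic : ∀ {c e} → NonResidue p e → p ∣ e + c → Anisotropic p p c
  nonResidue⇒anisotropic {c} nonResidue p∣e+c z₁ z₂ z₃ p²∣Q = p∣z₁ , p∣z₂ , p∣z₃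
    where
    regroup : form p c z₁ z₂ z₃ ≡ (z₁ * z₁ + c * (z₃ * z₃)) + p * (z₂ * z₂)
    regroup = shuffle z₁ z₂ z₃ p c
      where
      shuffle : ∀ z₁ z₂ z₃ p c → z₁ * z₁ + p * (z₂ * z₂) + c * (z₃ * z₃) ≡
                                 (z₁ * z₁ + c * (z₃ * z₃)) + p * (z₂ * z₂)
      shuffle = solve-∀
    p∣z₁²+cz₃² : p ∣ z₁ * z₁ + c * (z₃ * z₃)
    p∣z₁²+cz₃² = ∣m+n∣m⇒∣n (subst (p ∣_) (trans regroup (+-comm _ (p * (z₂ * z₂))))
                                  (∣-trans (m∣m*n p) p²∣Q))
                            (m∣m*n (z₂ * z₂))
    p∣z₁×p∣z₃ = nonResidue⇒anisotropic₂ nonResidue p∣e+c z₁ z₃ p∣z₁²+cz₃²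
    p∣z₁ = proj₁ p∣z₁×p∣z₃
    p∣z₃ = proj₂ p∣z₁×p∣z₃
    p²∣pz₂² : p * p ∣ p * (z₂ * z₂)
    p²∣pz₂² = ∣m+n∣m⇒∣n (subst (p * p ∣_) regroup p²∣Q)
                (∣m∣n⇒∣m+n (*-pres-∣ p∣z₁ p∣z₁) (∣n⇒∣m*n c (*-pres-∣ p∣z₃ p∣z₃)))
    p∣z₂ = prime∣square⇒∣ (*-cancelˡ-∣ p p²∣pz₂²)

  anisotropic-odd : 3 ≤ p → ∃₂ (Anisotropic p)
  anisotropic-odd 3≤p with e , e<p , nonResidue ← ∃-nonResidue 3≤p =
    p , p ∸ e , nonResidue⇒anisotropic {p ∸ e} nonResidue (∣-reflexive (sym (m+[n∸m]≡n (<⇒≤ e<p))))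

anisotropic-prime : ∀ {p} → Prime p → ∃₂ (Anisotropic p)
anisotropic-prime {0}                 pPrime = ⊥-elim (¬prime[0] pPrime)
anisotropic-prime {1}                 pPrime = ⊥-elim (¬prime[1] pPrime)
anisotropic-prime {2}                 _      = 1 , 1 , anisotropic-2
anisotropic-prime {suc (suc (suc _))} pPrime = anisotropic-odd pPrime (s≤s (s≤s (s≤s z≤n)))

module _ {p ps} (pPrime : Prime p) (primes : All Prime ps) where

  private instance
    p²≢0 : NonZero (p * p)
    p²≢0 = m*n≢0 p p {{prime⇒nonZero pPrime}} {{prime⇒nonZero pPrime}}
    P²≢0 : NonZero (product ps * product ps)
    P²≢0 = m*n≢0 _ _ {{productOfPrimes≢0 primes}} {{productOfPrimes≢0 primes}}

  anisotropic-cong-factors : ∀ {x₂ x₃ a₂ a₃} →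
    x₂ ≡ a₂ mod (product ps * product ps) → x₃ ≡ a₃ mod (product ps * product ps) →
    All (λ r → Anisotropic r a₂ a₃) ps → All (λ r → Anisotropic r x₂ x₃) ps
  anisotropic-cong-factors {x₂} {x₃} x₂≡a₂ x₃≡a₃ anisos = All.tabulate anisotropic-factor
    where
    anisotropic-factor : ∀ {r} → r ∈ ps → Anisotropic r x₂ x₃
    anisotropic-factor {r} r∈ps =
      anisotropic-cong {{r²≢0}} (≡-mod-weaken {{r²≢0}} r²∣P² x₂≡a₂) (≡-mod-weaken {{r²≢0}} r²∣P² x₃≡a₃)
                       (All.lookup anisos r∈ps)
      where
      r≢0 = prime⇒nonZero (All.lookup primes r∈ps)
      r²≢0 = m*n≢0 r r {{r≢0}} {{r≢0}}
      r²∣P² : r * r ∣ product ps * product ps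
      r²∣P² = *-pres-∣ (∈⇒∣product r∈ps) (∈⇒∣product r∈ps)

  anisotropic-glue : ∀ {a₂ a₃} → Coprime (p * p) (product ps * product ps) →
                     ∃₂ (Anisotropic p) → All (λ r → Anisotropic r a₂ a₃) ps →
                     ∃₂ λ x₂ x₃ → All (λ r → Anisotropic r x₂ x₃) (p ∷ ps)
  anisotropic-glue {a₂} {a₃} coprime (c₂ , c₃ , anisoP) anisos =
    let x₂ , x₂≡c₂ , x₂≡a₂ = chinese-remainder coprime c₂ a₂
        x₃ , x₃≡c₃ , x₃≡a₃ = chinese-remainder coprime c₃ a₃
    in x₂ , x₃ , anisotropic-cong x₂≡c₂ x₃≡c₃ anisoP ∷ anisotropic-cong-factors x₂≡a₂ x₃≡a₃ anisos

∃-All-anisotropic : ∀ {ps} → All Prime ps → ∃₂ λ x₂ x₃ → All (λ p → Anisotropic p x₂ x₃) ps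
∃-All-anisotropic {[]}     []                = 0 , 0 , []
∃-All-anisotropic {p ∷ ps} (pPrime ∷ primes) with ∃-All-anisotropic primes | p ∣? product ps
... | a₂ , a₃ , anisos | yes p∣P =
  a₂ , a₃ , All.lookup anisos (factorisationHasAllPrimeFactors pPrime p∣P primes) ∷ anisos
... | a₂ , a₃ , anisos | no p∤P =
  anisotropic-glue pPrime primes {a₂} {a₃} (coprime-squares (prime∤⇒coprime pPrime p∤P))
                   (anisotropic-prime pPrime) anisos

∃-anisotropic : ∀ m .{{_ : NonZero m}} → ∃₂ (Anisotropic m)
∃-anisotropic m
  with record { factors = ps ; isFactorisation = m≡Πps ; factorsPrime = primes } ← factorise m
  with x₂ , x₃ , anisos ← ∃-All-anisotropic primes =
  x₂ , x₃ , subst (λ M → Anisotropic M x₂ x₃) (sym m≡Πps) (anisotropic-product {ps} {x₂} {x₃} primes anisos)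

fin3-elim : ∀ {P : Fin 3 → Set} → P Fin.zero × P (Fin.suc Fin.zero) × P (Fin.suc (Fin.suc Fin.zero)) →
            ∀ i → P i
fin3-elim (p₀ , _  , _ ) Fin.zero                      = p₀
fin3-elim (_  , p₁ , _ ) (Fin.suc Fin.zero)            = p₁
fin3-elim (_  , _  , p₂) (Fin.suc (Fin.suc Fin.zero))  = p₂

coefficients : ℕ → ℕ → Fin 3 → ℕ
coefficients x₂ x₃ Fin.zero                     = 1
coefficients x₂ x₃ (Fin.suc Fin.zero)           = x₂
coefficients x₂ x₃ (Fin.suc (Fin.suc Fin.zero)) = x₃

module _ {m : ℕ} .{{_ : NonZero (m * m)}} where

  nonzeroSquare⇒root : ∀ {a} → InSStar (m * m) a → ∃ λ y → toℕ a ≡ y * y mod (m * m) × ¬ m ∣ y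
  nonzeroSquare⇒root {a} (a≢0 , y , y²≡a) =
    toℕ y , ≡-mod (trans (m<n⇒m%n≡m (toℕ<n a)) (sym y²≡a)) ,
    λ m∣y → a≢0 (trans (sym y²≡a) (n∣m⇒m%n≡0 _ (m * m) (*-pres-∣ m∣y m∣y)))

  weightedTerm-as-square : ∀ (b : Bool) {a : Fin (m * m)} {x X} → x ≡ X mod (m * m) →
                  (b ≡ true → InSStar (m * m) a) →
                  ∃ λ z → (if b then toℕ a * x else 0) ≡ X * (z * z) mod (m * m) × (b ≡ true → ¬ m ∣ z)
  weightedTerm-as-square false {X = X} _ _ = 0 , ≡-mod-reflexive (sym (*-zeroʳ X)) , λ ()
  weightedTerm-as-square true {X = X} x≡X weight with y , a≡y² , m∤y ← nonzeroSquare⇒root (weight refl) =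
    y , ≡-mod-trans (*-cong-mod a≡y² x≡X) (≡-mod-reflexive (*-comm (y * y) X)) , λ _ → m∤y

  weightedZeroSum⇒squareZeroSum :
    ∀ {k x I} (X : Fin k → ℕ) → (∀ i → toℕ (x i) ≡ X i mod (m * m)) → WeightedZeroSum (m * m) k x I →
    ∃ λ (z : Fin k → ℕ) → (∃ λ i → ¬ m ∣ z i) × m * m ∣ sumFin k (λ i → X i * (z i * z i))
  weightedZeroSum⇒squareZeroSum {k} {x} {I} X x≡X ((i , i∈I) , a , weights , sum%m²≡0) =
    proj₁ ∘ term ,
    (i , proj₂ (proj₂ (term i)) ([]=⇒lookup i∈I)) ,
    ∣-resp-≡-mod (sumFin-cong-mod k (proj₁ ∘ proj₂ ∘ term)) (≡0-mod⇒∣ sum%m²≡0)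
    where
    term : ∀ j → ∃ λ z → (if lookup I j then toℕ (a j) * toℕ (x j) else 0) ≡ X j * (z * z) mod (m * m)
                         × (lookup I j ≡ true → ¬ m ∣ z)
    term j = weightedTerm-as-square (lookup I j) (x≡X j) (weights j ∘ lookup⇒[]= j I)

  residues : ℕ → ℕ → Fin 3 → Fin (m * m)
  residues x₂ x₃ i = fromℕ< (m%n<n (coefficients x₂ x₃ i) (m * m))

  anisotropic⇒no-weightedZeroSum : ∀ {x₂ x₃} → Anisotropic m x₂ x₃ →
                                   ∀ I → ¬ WeightedZeroSum (m * m) 3 (residues x₂ x₃) I
  anisotropic⇒no-weightedZeroSum {x₂} {x₃} anisotropic I wzs =
    let z , (i , m∤zᵢ) , m²∣sum = weightedZeroSum⇒squareZeroSum (coefficients x₂ x₃) toℕ-residue wzs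
        z₁ = z Fin.zero
        z₂ = z (Fin.suc Fin.zero)
        z₃ = z (Fin.suc (Fin.suc Fin.zero))
    in m∤zᵢ (fin3-elim {λ i → m ∣ z i} (anisotropic z₁ z₂ z₃ (subst (m * m ∣_) (sum≡form z₁ z₂ z₃) m²∣sum)) i)
    where
    toℕ-residue : ∀ i → toℕ (residues x₂ x₃ i) ≡ coefficients x₂ x₃ i mod (m * m)
    toℕ-residue i = ≡-mod-trans (≡-mod-reflexive (toℕ-fromℕ< (m%n<n (coefficients x₂ x₃ i) (m * m))))
                                (%-≡-mod (coefficients x₂ x₃ i))
    sum≡form : ∀ a b c → 1 * (a * a) + (x₂ * (b * b) + (x₃ * (c * c) + 0)) ≡ form x₂ x₃ a b c
    sum≡form a b c = regroup a b c x₂ x₃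
      where
      regroup : ∀ a b c x₂ x₃ → 1 * (a * a) + (x₂ * (b * b) + (x₃ * (c * c) + 0)) ≡
                                a * a + x₂ * (b * b) + x₃ * (c * c)
      regroup = solve-∀

module _ {n : ℕ} .{{_ : NonZero n}} where

  allHaveWZS-suc : ∀ {k} → AllHaveWZS n k → AllHaveWZS n (suc k)
  allHaveWZS-suc allWZS x with I , (i , i∈I) , a , weights , sum≡0 ← allWZS (x ∘ Fin.suc) =
    false ∷ I , (Fin.suc i , there i∈I) , a′ , weights′ , sum≡0
    where
    -- index 0 lies outside the subset, so its weight is arbitrary
    a′ : Fin (suc _) → Fin n
    a′ Fin.zero    = x Fin.zero
    a′ (Fin.suc j) = a j
    weights′ : ∀ j → (false ∷ I) [ j ]= true → InSStar n (a′ j)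
    weights′ (Fin.suc j) (there j∈I) = weights j j∈I

  allHaveWZS-mono : ∀ {k l} → k ≤ l → AllHaveWZS n k → AllHaveWZS n l
  allHaveWZS-mono k≤l = go (≤⇒≤′ k≤l)
    where
    go : ∀ {k l} → k ≤′ l → AllHaveWZS n k → AllHaveWZS n l
    go (≤′-reflexive refl) = id
    go (≤′-step k≤′l)      = allHaveWZS-suc ∘ go k≤′l

theorem3 : (n : ℕ) → .{{_ : NonZero n}} → (∃ λ m → n ≡ m * m) → 2 ∣ n →
    (k : ℕ) → AllHaveWZS n k → 4 ≤ k
theorem3 _ (m , refl) _ k allWZS with 4 ≤? k
... | yes 4≤k = 4≤k
... | no 4≰k  =
  let x₂ , x₃ , anisotropic = ∃-anisotropic m {{m*n≢0⇒m≢0 m}}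
      I , wzs = allHaveWZS-mono (≤-pred (≰⇒> 4≰k)) allWZS (residues {m} x₂ x₃)
  in ⊥-elim (anisotropic⇒no-weightedZeroSum {m} {x₂} {x₃} anisotropic I wzs)
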